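{- For every $n\geq 1$, the burning number of the directed path $P_n$ on $n$ nodes is $\left\lceil \sqrt{2n+\frac{1}{4}}-\frac{1}{2}\right\rceil$.
   Context: Burning process on a digraph $D$: a sequence $(x_1,\ldots,x_b)$ of nodes is a burning sequence for $D$ if after $b$ steps of the following process every node of $D$ is burned. In the $i$-th step, first all out-neighbours of all currently burned nodes become burned, and then the node $x_i$ is burned (so after step 1 only $x_1$ is burned). The burning number of $D$ is the length of a shortest burning sequence for $D$. The directed path $P_n$ has nodes $v_1,\ldots,v_n$ and arcs $(v_i,v_{i+1})$ for $1\le i<n$. -}

module Defs where

open import Level using (Level; suc; _⊔_)
open import Data.Nat using (ℕ; _+_; _*_; _≤_; _<_)
open import Data.Fin using (Fin; toℕ)
open import Data.List using (List; foldl; length)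
open import Data.Product using (Σ; _×_; ∃)
open import Data.Sum using (_⊎_)
open import Data.Empty using (⊥)
open import Relation.Nullary using (¬_)
open import Relation.Binary.PropositionalEquality using (_≡_)

record Digraph : Set₁ where
  field
    Node : Set
    Arc  : Node → Node → Set
open Digraph public

NodeSet : Digraph → Set₁
NodeSet D = Node D → Set

nobody : (D : Digraph) → NodeSet D
nobody D _ = ⊥

step : (D : Digraph) → NodeSet D → Node D → NodeSet D
step D S x v = (S v ⊎ ∃ (λ u → S u × Arc D u v)) ⊎ v ≡ x

burnedAfter : (D : Digraph) → List (Node D) → NodeSet D
burnedAfter D xs = foldl (step D) (nobody D) xs

IsBurningSeq : (D : Digraph) → List (Node D) → Set
IsBurningSeq D xs = ∀ v → burnedAfter D xs v

IsBurningNumber : Digraph → ℕ → Set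
IsBurningNumber D b =
  Σ (List (Node D)) (λ xs → length xs ≡ b × IsBurningSeq D xs)
  × (∀ xs → IsBurningSeq D xs → b ≤ length xs)

P : ℕ → Digraph
P n = record { Node = Fin n ; Arc = λ u v → toℕ v ≡ Data.Nat.suc (toℕ u) }

-- b = ⌈ √(2n + 1/4) − 1/2 ⌉, i.e. b is the least natural with 2n ≤ b(b+1).
IsCeilExpr : ℕ → ℕ → Set
IsCeilExpr n b = (2 * n ≤ b * (b + 1)) × (∀ c → 2 * n ≤ c * (c + 1) → b ≤ c)

module Submission where

open import Defs
open import Data.Nat using (ℕ; zero; suc; _+_; _*_; _≤_; _<_; z≤n; s≤s; z<s; _<?_; _≟_)
open import Data.Nat.Properties
open import Data.Nat.Induction using (<-rec)
open import Data.Nat.Tactic.RingSolver using (solve-∀)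
open import Data.Fin using (Fin; toℕ; fromℕ<)
open import Data.Fin.Properties using (toℕ-fromℕ<; toℕ-injective; toℕ<n)
open import Data.List using (List; []; _∷_; foldl; length; map)
open import Data.Nat.ListAction using (sum)
open import Data.List.Relation.Unary.Any using (Any; here; there)
open import Data.Product using (∃; _×_; _,_; proj₁; proj₂)
open import Data.Sum using (_⊎_; inj₁; inj₂)
open import Data.Empty using (⊥-elim)
open import Relation.Nullary using (yes; no)
open import Relation.Binary.PropositionalEquality
  using (_≡_; _≢_; refl; sym; trans; cong; cong₂; subst)

-- On P_n the node x_i burns exactly the nodes v_j with x_i ≤ j ≤ x_i + (b − i), an interval
-- of b − i + 1 nodes. So a burning sequence of length b is a covering of the n nodes by
-- intervals of sizes b, b − 1, …, 1; this is possible iff n ≤ 1 + 2 + ⋯ + b = b(b+1)/2,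
-- and consecutive intervals starting at 0 realise it.

triangle : ℕ → ℕ
triangle zero    = 0
triangle (suc k) = suc k + triangle k

2*triangle≡pronic : ∀ k → 2 * triangle k ≡ k * (k + 1)
2*triangle≡pronic zero    = refl
2*triangle≡pronic (suc k) = trans (*-distribˡ-+ 2 (suc k) (triangle k))
  (trans (cong (2 * suc k +_) (2*triangle≡pronic k)) (step-identity k))
  where
  step-identity : ∀ k → 2 * suc k + k * (k + 1) ≡ suc k * (suc k + 1)
  step-identity = solve-∀

≤triangle⇒2*≤pronic : ∀ {n} k → n ≤ triangle k → 2 * n ≤ k * (k + 1)
≤triangle⇒2*≤pronic {n} k n≤T = subst (2 * n ≤_) (2*triangle≡pronic k) (*-monoʳ-≤ 2 n≤T)

2*≤pronic⇒≤triangle : ∀ {n} k → 2 * n ≤ k * (k + 1) → n ≤ triangle k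
2*≤pronic⇒≤triangle {n} k 2n≤ = *-cancelˡ-≤ 2 (subst (2 * n ≤_) (sym (2*triangle≡pronic k)) 2n≤)

Interval : Set
Interval = ℕ × ℕ

infix 4 _∈ᵢ_
_∈ᵢ_ : ℕ → Interval → Set
v ∈ᵢ (a , l) = a ≤ v × v < a + l

totalLength : List Interval → ℕ
totalLength I = sum (map proj₂ I)

∈ᵢ-extendʳ : ∀ {v a l} → v ∈ᵢ (a , l) → v ∈ᵢ (a , suc l)
∈ᵢ-extendʳ {a = a} (a≤v , v<a+l) = a≤v , <-≤-trans v<a+l (+-monoʳ-≤ a (n≤1+n _))

∈ᵢ-extendˡ : ∀ {v a l} → v ∈ᵢ (suc a , l) → v ∈ᵢ (a , suc l)
∈ᵢ-extendˡ {v} {a} {l} (a<v , v<1+a+l) = <⇒≤ a<v , subst (v <_) (sym (+-suc a l)) v<1+a+l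

∈ᵢ-shrinkˡ : ∀ {v a l} → v ∈ᵢ (a , suc l) → a ≢ v → v ∈ᵢ (suc a , l)
∈ᵢ-shrinkˡ {v} {a} {l} (a≤v , v<a+1+l) a≢v = ≤∧≢⇒< a≤v a≢v , subst (v <_) (+-suc a l) v<a+1+l

∈ᵢ-singleton : ∀ {v a} → v ∈ᵢ (a , 1) → a ≡ v
∈ᵢ-singleton {v} {a} (a≤v , v<a+1) = ≤-antisym a≤v (≤-pred (subst (v <_) (+-comm a 1) v<a+1))

record Isolated (w : ℕ) (I : List Interval) : Set where
  field
    base width   : ℕ
    rest         : List Interval
    base≤w       : base ≤ w
    w<end        : w < base + width
    totalLength≡ : totalLength rest + width ≡ totalLength I
    covers-below : ∀ {v} → v < base → Any (v ∈ᵢ_) I → Any (v ∈ᵢ_) rest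

-- The interval containing w is emptied rather than removed.
isolate : ∀ {w} I → Any (w ∈ᵢ_) I → Isolated w I
isolate ((a , l) ∷ I) (here (a≤w , w<a+l)) = record
  { base = a ; width = l ; rest = (a , 0) ∷ I ; base≤w = a≤w ; w<end = w<a+l
  ; totalLength≡ = +-comm (totalLength I) l
  ; covers-below = λ where
      v<a (here (a≤v , _)) → ⊥-elim (<⇒≱ v<a a≤v)
      _   (there v∈I)      → there v∈I
  }
isolate ((a , l) ∷ I) (there w∈I) = record
  { base = base ; width = width ; rest = (a , l) ∷ rest ; base≤w = base≤w ; w<end = w<end
  ; totalLength≡ = trans (+-assoc l (totalLength rest) width) (cong (l +_) totalLength≡)
  ; covers-below = λ where
      _   (here v∈)   → here v∈
      v<s (there v∈I) → there (covers-below v<s v∈I)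
  }
  where open Isolated (isolate I w∈I)

CoversBelow : List Interval → ℕ → Set
CoversBelow I n = ∀ {v} → v < n → Any (v ∈ᵢ_) I

-- Strong induction on n: the interval containing the largest point n − 1 has some base
-- a ≤ n − 1, and the other intervals still cover every point below a.
coversBelow⇒≤totalLength : ∀ n I → CoversBelow I n → n ≤ totalLength I
coversBelow⇒≤totalLength = <-rec _ bound
  where
  bound : ∀ n → (∀ {m} → m < n → ∀ I → CoversBelow I m → m ≤ totalLength I)
        → ∀ I → CoversBelow I n → n ≤ totalLength I
  bound zero    _   _ _     = z≤n
  bound (suc n) rec I cover = begin
    suc n                    ≤⟨ w<end ⟩
    base + width             ≤⟨ +-monoˡ-≤ width base≤rest ⟩
    totalLength rest + width ≡⟨ totalLength≡ ⟩
    totalLength I            ∎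
    where
    open ≤-Reasoning
    open Isolated (isolate I (cover ≤-refl))
    base≤rest : base ≤ totalLength rest
    base≤rest = rec (s≤s base≤w) rest
      (λ v<base → covers-below v<base (cover (<-trans v<base (s≤s base≤w))))

module _ {n : ℕ} where

  ball : Fin n → ℕ → Interval
  ball x radius = toℕ x , suc radius

  balls : List (Fin n) → List Interval
  balls []       = []
  balls (x ∷ xs) = ball x (length xs) ∷ balls xs

  totalLength-balls : ∀ xs → totalLength (balls xs) ≡ triangle (length xs)
  totalLength-balls []       = refl
  totalLength-balls (x ∷ xs) = cong (suc (length xs) +_) (totalLength-balls xs)

  burned-persists : ∀ (S : NodeSet (P n)) xs {v} → S v → foldl (step (P n)) S xs v
  burned-persists S []       Sv = Sv
  burned-persists S (x ∷ xs) Sv = burned-persists (step (P n) S x) xs (inj₁ (inj₁ Sv))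

  burned⇒reached⊎covered : ∀ (S : NodeSet (P n)) xs v → foldl (step (P n)) S xs v →
    (∃ λ u → S u × toℕ v ∈ᵢ ball u (length xs)) ⊎ Any (toℕ v ∈ᵢ_) (balls xs)
  burned⇒reached⊎covered S [] v Sv = inj₁ (v , Sv , ≤-refl , m<m+n (toℕ v) z<s)
  burned⇒reached⊎covered S (x ∷ xs) v burned
    with burned⇒reached⊎covered (step (P n) S x) xs v burned
  ... | inj₂ v∈balls                          = inj₂ (there v∈balls)
  ... | inj₁ (u , inj₂ refl , v∈)             = inj₂ (here v∈)
  ... | inj₁ (u , inj₁ (inj₁ Su) , v∈)        = inj₁ (u , Su , ∈ᵢ-extendʳ v∈)
  ... | inj₁ (u , inj₁ (inj₂ (w , Sw , w→u)) , v∈) =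
        inj₁ (w , Sw , ∈ᵢ-extendˡ (subst (λ a → toℕ v ∈ᵢ (a , _)) w→u v∈))

  reached⇒burned : ∀ (S : NodeSet (P n)) xs u v → S u → toℕ v ∈ᵢ ball u (length xs) →
    foldl (step (P n)) S xs v
  reached⇒burned S [] u v Su v∈ = subst S (toℕ-injective (∈ᵢ-singleton v∈)) Su
  reached⇒burned S (x ∷ xs) u v Su v∈ with toℕ u ≟ toℕ v
  ... | yes u≡v = burned-persists S (x ∷ xs) (subst S (toℕ-injective u≡v) Su)
  ... | no  u≢v = reached⇒burned (step (P n) S x) xs w v (inj₁ (inj₂ (u , Su , toℕ-w)))
                    (subst (λ a → toℕ v ∈ᵢ (a , _)) (sym toℕ-w) v∈′)
    where
    v∈′ : toℕ v ∈ᵢ (suc (toℕ u) , suc (length xs))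
    v∈′ = ∈ᵢ-shrinkˡ v∈ u≢v
    u+1<n : suc (toℕ u) < n
    u+1<n = ≤-<-trans (proj₁ v∈′) (toℕ<n v)
    w : Fin n
    w = fromℕ< u+1<n
    toℕ-w : toℕ w ≡ suc (toℕ u)
    toℕ-w = toℕ-fromℕ< u+1<n

  covered⇒burned : ∀ (S : NodeSet (P n)) xs v → Any (toℕ v ∈ᵢ_) (balls xs) →
    foldl (step (P n)) S xs v
  covered⇒burned S (x ∷ xs) v (here v∈)   = reached⇒burned (step (P n) S x) xs x v (inj₂ refl) v∈
  covered⇒burned S (x ∷ xs) v (there v∈I) = covered⇒burned (step (P n) S x) xs v v∈I

burningSeq⇒≤triangle : ∀ n xs → IsBurningSeq (P n) xs → n ≤ triangle (length xs)
burningSeq⇒≤triangle n xs burns =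
  subst (n ≤_) (totalLength-balls xs) (coversBelow⇒≤totalLength n (balls xs) covers)
  where
  covers : CoversBelow (balls xs) n
  covers v<n with burned⇒reached⊎covered (nobody (P n)) xs (fromℕ< v<n) (burns _)
  ... | inj₁ (_ , () , _)
  ... | inj₂ v∈balls = subst (λ v → Any (v ∈ᵢ_) (balls xs)) (toℕ-fromℕ< v<n) v∈balls

module _ (m : ℕ) where

  -- Positions past the last node are junk; they are sent to the last node.
  nodeAt : ℕ → Fin (suc m)
  nodeAt p = fromℕ< (s≤s (m⊓n≤n p m))

  toℕ-nodeAt : ∀ {p} → p ≤ m → toℕ (nodeAt p) ≡ p
  toℕ-nodeAt p≤m = trans (toℕ-fromℕ< _) (m≤n⇒m⊓n≡m p≤m)

  consecutiveFrom : ℕ → ℕ → List (Fin (suc m))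
  consecutiveFrom zero    p = []
  consecutiveFrom (suc k) p = nodeAt p ∷ consecutiveFrom k (p + suc k)

  length-consecutiveFrom : ∀ k p → length (consecutiveFrom k p) ≡ k
  length-consecutiveFrom zero    p = refl
  length-consecutiveFrom (suc k) p = cong suc (length-consecutiveFrom k (p + suc k))

  consecutiveFrom-covers : ∀ k p {v} → v < suc m → p ≤ v → v < p + triangle k →
    Any (v ∈ᵢ_) (balls (consecutiveFrom k p))
  consecutiveFrom-covers zero p v<n p≤v v<p+0 =
    ⊥-elim (<⇒≱ v<p+0 (subst (_≤ _) (sym (+-identityʳ p)) p≤v))
  consecutiveFrom-covers (suc k) p {v} v<n p≤v v<end with v <? p + suc k
  ... | yes v<p+k = here (subst (v ∈ᵢ_) first-ball≡ (p≤v , v<p+k))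
    where
    first-ball≡ : (p , suc k) ≡ ball (nodeAt p) (length (consecutiveFrom k (p + suc k)))
    first-ball≡ = sym (cong₂ _,_ (toℕ-nodeAt (≤-pred (≤-<-trans p≤v v<n)))
                                 (cong suc (length-consecutiveFrom k (p + suc k))))
  ... | no  v≮p+k = there (consecutiveFrom-covers k (p + suc k) v<n (≮⇒≥ v≮p+k)
                      (subst (v <_) (sym (+-assoc p (suc k) (triangle k))) v<end))

  consecutiveFrom-burns : ∀ b → suc m ≤ triangle b → IsBurningSeq (P (suc m)) (consecutiveFrom b 0)
  consecutiveFrom-burns b n≤T v = covered⇒burned (nobody (P (suc m))) (consecutiveFrom b 0) v
    (consecutiveFrom-covers b 0 (toℕ<n v) z≤n (≤-trans (toℕ<n v) n≤T))

mainTheorem3 : (n b : ℕ) → 1 ≤ n → IsCeilExpr n b → IsBurningNumber (P n) b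
mainTheorem3 (suc m) b _ (2n≤pronic , least) =
  ( consecutiveFrom m b 0
  , length-consecutiveFrom m b 0
  , consecutiveFrom-burns m b (2*≤pronic⇒≤triangle b 2n≤pronic) )
  , λ xs burns → least (length xs)
      (≤triangle⇒2*≤pronic (length xs) (burningSeq⇒≤triangle (suc m) xs burns))
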